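{- Let $p$ and $q$ be nonzero integers with $q \neq 1$ and $p - q = 1$. Let $(U_n)_{n\ge 0}$ be defined by $U_0 = 0$, $U_1 = 1$, and $U_n = pU_{n-1} - qU_{n-2}$ for $n \ge 2$. Then for all $n \geq 1$, $$\sum_{i=1}^n i\, U_i = \frac{q}{q-1} \left( n U_n - \frac{q U_{n-1} - n + 1}{q-1} - \frac{1}{q} \binom{n+1}{2} \right).$$
   Context: $(U_n)$ is the Lucas sequence of the first kind with parameters $p,q$. -}

module Defs where

open import Data.Nat using (ℕ; zero; suc)
open import Data.Integer using (ℤ; +_; _-_; _*_)
open import Data.Rational using (ℚ; 0ℚ; _≟_; _÷_; ≢-nonZero; _/_)
open import Relation.Nullary using (yes; no)

U : ℤ → ℤ → ℕ → ℤ
U p q zero = + 0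
U p q (suc zero) = + 1
U p q (suc (suc n)) = p * U p q (suc n) - q * U p q n

-- total division on ℚ (x / 0 := 0); only used with nonzero divisors
_÷'_ : ℚ → ℚ → ℚ
a ÷' b with b ≟ 0ℚ
... | yes _ = 0ℚ
... | no b≢0 = _÷_ a b {{≢-nonZero b≢0}}

sum1 : ℕ → (ℕ → ℚ) → ℚ
sum1 zero f = 0ℚ
sum1 (suc n) f = sum1 n f Data.Rational.+ f (suc n)

fromℤ : ℤ → ℚ
fromℤ z = z / 1

-- Because p = q + 1, the Lucas recurrence collapses to the affine one U (n+1) = q U n + 1.
-- For any sequence with u 0 = 0 and u (n+1) = a u n + 1 the identity
--   (a-1)² Σᵢ₌₁ⁿ i uᵢ = a(a-1) n uₙ - a(uₙ - n) - (a-1) C(n+1,2)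
-- has no denominators and follows by induction on n; rewriting uₙ - n as a uₙ₋₁ - n + 1
-- and dividing by (a-1)², legitimate since q ≠ 0, 1, gives the formula with a = q.
module Submission where

open import Defs
open import Data.Nat using (ℕ; zero; suc; _≥_)
import Data.Nat as ℕ
open import Data.Nat.Properties using (+-comm)
open import Data.Nat.Combinatorics using (_C_; nCk+nC[k+1]≡[n+1]C[k+1]; nC1≡n)
open import Data.Nat.Coprimality as Coprimality using (1-coprimeTo)
open import Data.Integer using (ℤ; +_; -[1+_])
import Data.Integer as ℤ
import Data.Integer.Properties as ℤ
import Data.Integer.Solver as ℤ-Solver
open import Data.Rational using (ℚ; mkℚ; ↥_; 0ℚ; 1ℚ; _+_; _-_; _*_; -_; 1/_; ≢-nonZero)
import Data.Rational as ℚ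
import Data.Rational.Properties as ℚ
import Data.Rational.Solver as ℚ-Solver
open import Data.Product using (∃-syntax; _,_; _×_)
open import Data.Empty using (⊥-elim)
open import Relation.Nullary using (yes; no)
open import Relation.Binary.PropositionalEquality
  using (_≡_; _≢_; refl; sym; trans; cong; cong₂; module ≡-Reasoning)

open ≡-Reasoning

fromℤ≡mkℚ : ∀ i → fromℤ i ≡ mkℚ i 0 (Coprimality.sym (1-coprimeTo _))
fromℤ≡mkℚ i = ℚ.↥p/↧p≡p (mkℚ i 0 (Coprimality.sym (1-coprimeTo _)))

fromℤ-injective : ∀ {i j} → fromℤ i ≡ fromℤ j → i ≡ j
fromℤ-injective {i} {j} eq = begin
  i              ≡⟨ cong ↥_ (fromℤ≡mkℚ i) ⟨
  ↥ (fromℤ i)    ≡⟨ cong ↥_ eq ⟩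
  ↥ (fromℤ j)    ≡⟨ cong ↥_ (fromℤ≡mkℚ j) ⟩
  j              ∎

fromℤ-+ : ∀ i j → fromℤ (i ℤ.+ j) ≡ fromℤ i + fromℤ j
fromℤ-+ i j rewrite fromℤ≡mkℚ i | fromℤ≡mkℚ j | ℤ.*-identityʳ i | ℤ.*-identityʳ j = refl

fromℤ-* : ∀ i j → fromℤ (i ℤ.* j) ≡ fromℤ i * fromℤ j
fromℤ-* i j rewrite fromℤ≡mkℚ i | fromℤ≡mkℚ j = refl

fromℤ-neg : ∀ i → fromℤ (ℤ.- i) ≡ - fromℤ i
fromℤ-neg i rewrite fromℤ≡mkℚ (ℤ.- i) | fromℤ≡mkℚ i with i
... | + zero   = refl
... | + suc n  = refl
... | -[1+ n ] = refl

fromℤ-- : ∀ i j → fromℤ (i ℤ.- j) ≡ fromℤ i - fromℤ j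
fromℤ-- i j = trans (fromℤ-+ i (ℤ.- j)) (cong (λ x → fromℤ i + x) (fromℤ-neg j))

fromℕ : ℕ → ℚ
fromℕ n = fromℤ (+ n)

fromℕ-suc : ∀ n → fromℕ (suc n) ≡ 1ℚ + fromℕ n
fromℕ-suc n = fromℤ-+ (+ 1) (+ n)

fromℕ-C2-suc : ∀ n → fromℕ (suc (suc n) C 2) ≡ fromℕ (suc n C 2) + fromℕ (suc n)
fromℕ-C2-suc n = begin
  fromℕ (suc (suc n) C 2)                ≡⟨ cong fromℕ (nCk+nC[k+1]≡[n+1]C[k+1] (suc n) 1) ⟨
  fromℕ (suc n C 1 ℕ.+ suc n C 2)        ≡⟨ cong (λ k → fromℕ (k ℕ.+ suc n C 2)) (nC1≡n (suc n)) ⟩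
  fromℕ (suc n ℕ.+ suc n C 2)            ≡⟨ cong fromℕ (+-comm (suc n) (suc n C 2)) ⟩
  fromℕ (suc n C 2 ℕ.+ suc n)            ≡⟨ fromℤ-+ (+ (suc n C 2)) (+ suc n) ⟩
  fromℕ (suc n C 2) + fromℕ (suc n)      ∎

affine-recurrence-step : ∀ {p q u v} → p ℤ.- q ≡ + 1 → v ≡ q ℤ.* u ℤ.+ + 1 → p ℤ.* v ℤ.- q ℤ.* u ≡ q ℤ.* v ℤ.+ + 1
affine-recurrence-step {p} {q} {u} {v} p-q≡1 v≡qu+1 = begin
  p ℤ.* v ℤ.- q ℤ.* u                      ≡⟨ solve 4 (λ p q u v →
       p :* v :- q :* u := (p :- q) :* v :+ (q :* v :- q :* u)) refl p q u v ⟩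
  (p ℤ.- q) ℤ.* v ℤ.+ (q ℤ.* v ℤ.- q ℤ.* u) ≡⟨ cong (λ r → r ℤ.* v ℤ.+ (q ℤ.* v ℤ.- q ℤ.* u)) p-q≡1 ⟩
  + 1 ℤ.* v ℤ.+ (q ℤ.* v ℤ.- q ℤ.* u)       ≡⟨ cong (λ w → w ℤ.+ (q ℤ.* v ℤ.- q ℤ.* u)) (ℤ.*-identityˡ v) ⟩
  v ℤ.+ (q ℤ.* v ℤ.- q ℤ.* u)               ≡⟨ cong (λ w → w ℤ.+ (q ℤ.* v ℤ.- q ℤ.* u)) v≡qu+1 ⟩
  q ℤ.* u ℤ.+ + 1 ℤ.+ (q ℤ.* v ℤ.- q ℤ.* u) ≡⟨ solve 3 (λ q u v →
       q :* u :+ con (+ 1) :+ (q :* v :- q :* u) := q :* v :+ con (+ 1)) refl q u v ⟩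
  q ℤ.* v ℤ.+ + 1                           ∎
  where open ℤ-Solver.+-*-Solver

U[1+n]≡q*U[n]+1 : ∀ {p q} → p ℤ.- q ≡ + 1 → ∀ n → U p q (suc n) ≡ q ℤ.* U p q n ℤ.+ + 1
U[1+n]≡q*U[n]+1 {q = q} p-q≡1 zero = sym (cong (ℤ._+ + 1) (ℤ.*-zeroʳ q))
U[1+n]≡q*U[n]+1 {p} {q} p-q≡1 (suc n) = affine-recurrence-step {p} {q} {U p q n} p-q≡1 (U[1+n]≡q*U[n]+1 p-q≡1 n)

fromℤ-U[1+n] : ∀ {p q} → p ℤ.- q ≡ + 1 → ∀ n → fromℤ (U p q (suc n)) ≡ fromℤ q * fromℤ (U p q n) + 1ℚ
fromℤ-U[1+n] {p} {q} p-q≡1 n = begin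
  fromℤ (U p q (suc n))                  ≡⟨ cong fromℤ (U[1+n]≡q*U[n]+1 p-q≡1 n) ⟩
  fromℤ (q ℤ.* U p q n ℤ.+ + 1)          ≡⟨ fromℤ-+ (q ℤ.* U p q n) (+ 1) ⟩
  fromℤ (q ℤ.* U p q n) + 1ℚ             ≡⟨ cong (_+ 1ℚ) (fromℤ-* q (U p q n)) ⟩
  fromℤ q * fromℤ (U p q n) + 1ℚ         ∎

weighted-sum-step : ∀ {a x y S c c′ N N′} → N′ ≡ 1ℚ + N → y ≡ a * x + 1ℚ → c′ ≡ c + N′ →
  (a - 1ℚ) * (a - 1ℚ) * S ≡ a * (a - 1ℚ) * N * x - a * (x - N) - (a - 1ℚ) * c →
  (a - 1ℚ) * (a - 1ℚ) * (S + N′ * y) ≡ a * (a - 1ℚ) * N′ * y - a * (y - N′) - (a - 1ℚ) * c′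
weighted-sum-step {a} {x} {_} {S} {c} {_} {N} refl refl refl ih = begin
  (a - 1ℚ) * (a - 1ℚ) * (S + N′ * y)
    ≡⟨ solve 4 (λ a x S N →
         (a :- con 1ℚ) :* (a :- con 1ℚ) :* (S :+ (con 1ℚ :+ N) :* (a :* x :+ con 1ℚ))
      := (a :- con 1ℚ) :* (a :- con 1ℚ) :* S :+ (a :- con 1ℚ) :* (a :- con 1ℚ) :* (con 1ℚ :+ N) :* (a :* x :+ con 1ℚ))
       refl a x S N ⟩
  (a - 1ℚ) * (a - 1ℚ) * S + (a - 1ℚ) * (a - 1ℚ) * N′ * y
    ≡⟨ cong (_+ (a - 1ℚ) * (a - 1ℚ) * N′ * y) ih ⟩
  a * (a - 1ℚ) * N * x - a * (x - N) - (a - 1ℚ) * c + (a - 1ℚ) * (a - 1ℚ) * N′ * y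
    ≡⟨ solve 4 (λ a x c N →
         a :* (a :- con 1ℚ) :* N :* x :- a :* (x :- N) :- (a :- con 1ℚ) :* c
           :+ (a :- con 1ℚ) :* (a :- con 1ℚ) :* (con 1ℚ :+ N) :* (a :* x :+ con 1ℚ)
      := a :* (a :- con 1ℚ) :* (con 1ℚ :+ N) :* (a :* x :+ con 1ℚ) :- a :* ((a :* x :+ con 1ℚ) :- (con 1ℚ :+ N))
           :- (a :- con 1ℚ) :* (c :+ (con 1ℚ :+ N)))
       refl a x c N ⟩
  a * (a - 1ℚ) * N′ * y - a * (y - N′) - (a - 1ℚ) * (c + N′)
    ∎
  where
  open ℚ-Solver.+-*-Solver
  N′ = 1ℚ + N
  y = a * x + 1ℚ

weighted-sum-affine : ∀ {a : ℚ} {u : ℕ → ℚ} → u 0 ≡ 0ℚ → (∀ n → u (suc n) ≡ a * u n + 1ℚ) → ∀ n →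
  (a - 1ℚ) * (a - 1ℚ) * sum1 n (λ i → fromℕ i * u i)
    ≡ a * (a - 1ℚ) * fromℕ n * u n - a * (u n - fromℕ n) - (a - 1ℚ) * fromℕ (suc n C 2)
weighted-sum-affine {a} u0≡0 u-suc zero rewrite u0≡0 =
  solve 1 (λ a →
       (a :- con 1ℚ) :* (a :- con 1ℚ) :* con 0ℚ
    := a :* (a :- con 1ℚ) :* con 0ℚ :* con 0ℚ :- a :* (con 0ℚ :- con 0ℚ) :- (a :- con 1ℚ) :* con 0ℚ)
    refl a
  where open ℚ-Solver.+-*-Solver
weighted-sum-affine {a} {u} u0≡0 u-suc (suc n) =
  weighted-sum-step {a} {u n} {S = sum1 n (λ i → fromℕ i * u i)} {c = fromℕ (suc n C 2)} {N = fromℕ n}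
    (fromℕ-suc n) (u-suc n) (fromℕ-C2-suc n) (weighted-sum-affine {a} {u} u0≡0 u-suc n)

weighted-sum-affine-suc : ∀ {a : ℚ} {u : ℕ → ℚ} → u 0 ≡ 0ℚ → (∀ n → u (suc n) ≡ a * u n + 1ℚ) → ∀ n →
  (a - 1ℚ) * (a - 1ℚ) * sum1 (suc n) (λ i → fromℕ i * u i)
    ≡ a * (a - 1ℚ) * fromℕ (suc n) * u (suc n) - a * (a * u n - fromℕ (suc n) + 1ℚ)
      - (a - 1ℚ) * fromℕ (suc (suc n) C 2)
weighted-sum-affine-suc {a} {u} u0≡0 u-suc n =
  trans (weighted-sum-affine {a} {u} u0≡0 u-suc (suc n))
        (cong (λ t → a * (a - 1ℚ) * fromℕ (suc n) * u (suc n) - a * t - (a - 1ℚ) * fromℕ (suc (suc n) C 2))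
              (shift (u-suc n)))
  where
  shift : ∀ {x y N} → y ≡ a * x + 1ℚ → y - N ≡ a * x - N + 1ℚ
  shift {x} {N = N} refl = solve 3 (λ a x N → a :* x :+ con 1ℚ :- N := a :* x :- N :+ con 1ℚ) refl a x N
    where open ℚ-Solver.+-*-Solver

÷'-inverse : ∀ {b} → b ≢ 0ℚ → ∃[ b⁻¹ ] b * b⁻¹ ≡ 1ℚ × (∀ x → x ÷' b ≡ x * b⁻¹)
÷'-inverse {b} b≢0 with b ℚ.≟ 0ℚ
... | yes b≡0 = ⊥-elim (b≢0 b≡0)
... | no b≢0′ = let instance _ = ≢-nonZero b≢0′ in 1/ b , ℚ.*-inverseʳ b , λ _ → refl

divide-out : ∀ {a d S N u X C} → d ≢ 0ℚ → a ≢ 0ℚ →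
  d * d * S ≡ a * d * N * u - a * X - d * C →
  S ≡ (a ÷' d) * ((N * u - X ÷' d) - (1ℚ ÷' a) * C)
divide-out {a} {d} {S} {N} {u} {X} {C} d≢0 a≢0 eq
  with ÷'-inverse d≢0 | ÷'-inverse a≢0
... | e , d*e≡1 , ÷d | f , a*f≡1 , ÷a rewrite ÷d a | ÷d X | ÷a 1ℚ = begin
  S                                               ≡⟨ solve 1 (λ S → S := con 1ℚ :* con 1ℚ :* S) refl S ⟩
  1ℚ * 1ℚ * S                                     ≡⟨ cong (λ t → t * t * S) d*e≡1 ⟨
  (d * e) * (d * e) * S                           ≡⟨ solve 3 (λ d e S → (d :* e) :* (d :* e) :* S := e :* e :* (d :* d :* S)) refl d e S ⟩
  e * e * (d * d * S)                             ≡⟨ cong (e * e *_) eq ⟩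
  e * e * (a * d * N * u - a * X - d * C)
    ≡⟨ solve 7 (λ a d e N u X C →
         e :* e :* (a :* d :* N :* u :- a :* X :- d :* C)
      := (a :* e) :* (N :* u :* (d :* e) :- X :* e) :- e :* C :* (d :* e)) refl a d e N u X C ⟩
  (a * e) * (N * u * (d * e) - X * e) - e * C * (d * e)
    ≡⟨ cong₂ (λ s t → (a * e) * (N * u * s - X * e) - e * C * t) d*e≡1 (trans d*e≡1 (sym a*f≡1)) ⟩
  (a * e) * (N * u * 1ℚ - X * e) - e * C * (a * f)
    ≡⟨ solve 7 (λ a e f N u X C →
         (a :* e) :* (N :* u :* con 1ℚ :- X :* e) :- e :* C :* (a :* f)
      := (a :* e) :* ((N :* u :- X :* e) :- (con 1ℚ :* f) :* C)) refl a e f N u X C ⟩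
  (a * e) * ((N * u - X * e) - (1ℚ * f) * C)      ∎
  where open ℚ-Solver.+-*-Solver

theorem4p3 : (p q : ℤ) → p ≢ + 0 → q ≢ + 0 → q ≢ + 1 → p Data.Integer.- q ≡ + 1 →
    (n : ℕ) → n ≥ 1 →
    sum1 n (λ i → fromℤ (+ i) * fromℤ (U p q i))
      ≡ (fromℤ q ÷' (fromℤ q - 1ℚ))
        * ((fromℤ (+ n) * fromℤ (U p q n)
           - ((fromℤ q * fromℤ (U p q (n Data.Nat.∸ 1)) - fromℤ (+ n) + 1ℚ) ÷' (fromℤ q - 1ℚ)))
           - (1ℚ ÷' fromℤ q) * fromℤ (+ (suc n C 2)))
theorem4p3 p q _ q≢0 q≢1 p-q≡1 (suc m) _ =
  divide-out q-1≢0 q≢0′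
    (weighted-sum-affine-suc {fromℤ q} {λ i → fromℤ (U p q i)} refl (fromℤ-U[1+n] p-q≡1) m)
  where
  q-1≢0 : fromℤ q - 1ℚ ≢ 0ℚ
  q-1≢0 eq = q≢1 (ℤ.i-j≡0⇒i≡j q (+ 1) (fromℤ-injective (trans (fromℤ-- q (+ 1)) eq)))

  q≢0′ : fromℤ q ≢ 0ℚ
  q≢0′ eq = q≢0 (fromℤ-injective eq)
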